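{- Let $K_{7,7,7}$ be the complete tripartite graph with three parts of size 7. For every $\alpha\in\{0,1,3,5,7\}$ and $\beta=7-\alpha$, there is a 2-factorization of $K_{7,7,7}$ consisting of exactly $\alpha$ $C_3$-factors and $\beta$ $C_7$-factors.
   Context: A $C_k$-factor of a graph $G$ is a spanning subgraph of $G$ each of whose components is a cycle of length $k$. A 2-factorization of $G$ is a partition of the edge set of $G$ into spanning 2-regular subgraphs (2-factors). -}

module Defs where

open import Data.Nat using (ℕ; zero; suc; _<_; _≤_)
open import Data.Nat.DivMod using (_%_; m%n<n)
open import Data.Fin using (Fin; toℕ; fromℕ<)
open import Data.Product using (_×_; Σ; ∃; ∃-syntax; _,_)
open import Data.Sum using (_⊎_)
open import Relation.Binary.PropositionalEquality using (_≡_; _≢_)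
open import Function.Bundles using (_⇔_)

-- Vertex set of K_{7,7,7}: (part, index within part).
V : Set
V = Fin 3 × Fin 7

Adj : V → V → Set
Adj (i , _) (j , _) = i ≢ j

next : ∀ {k} → Fin k → Fin k
next {suc n} x = fromℕ< (m%n<n (suc (toℕ x)) (suc n))

IsCkFactor : ℕ → (V → V → Set) → Set
IsCkFactor k E =
  3 ≤ k ×
  Σ ℕ λ m → Σ (Fin m → Fin k → V) λ cyc →
      (∀ i j x y → cyc i x ≡ cyc j y → (i ≡ j × x ≡ y))
    × (∀ v → ∃[ i ] ∃[ x ] (cyc i x ≡ v))
    × (∀ u v → E u v ⇔ (∃[ i ] ∃[ x ]
          ((u ≡ cyc i x × v ≡ cyc i (next x)) ⊎ (v ≡ cyc i x × u ≡ cyc i (next x)))))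

-- A 2-factorization of K_{7,7,7} into 7 factors, given as an edge colouring
-- col : V → V → Fin 7 (symmetric; only its values on edges matter).
FactorEdges : (V → V → Fin 7) → Fin 7 → V → V → Set
FactorEdges col t u v = Adj u v × col u v ≡ t

HasFactorization : ℕ → Set
HasFactorization α =
  Σ (V → V → Fin 7) λ col →
      (∀ u v → col u v ≡ col v u)
    × (∀ t → (toℕ t < α → IsCkFactor 3 (FactorEdges col t))
           × (α ≤ toℕ t → IsCkFactor 7 (FactorEdges col t)))

-- The factorizations are exhibited explicitly and verified by a decision procedure.
-- The C₃-factors are the parallel classes {(0,i), (1,i+a), (2,i+b)} (i ∈ ℤ₇), two of
-- which are edge-disjoint when their shifts a, b and b − a all differ; the remaining
-- edges are split into C₇-factors given by hand. The colouring required by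
-- HasFactorization assigns to each edge the index of the factor containing it.
module Submission where

open import Defs
open import Data.Nat using (ℕ; zero; suc; _<_; _≤_; _<?_; _≤?_)
open import Data.Nat.DivMod using (_mod_)
open import Data.Nat.GeneralisedArithmetic using (iterate)
import Data.Nat.Properties as ℕ
open import Data.Fin using (Fin; zero; suc; toℕ; remQuot; #_)
open import Data.Fin.Properties using (_≟_; all?; any?)
open import Data.Vec using (Vec; []; _∷_; lookup)
open import Data.Product using (_×_; ∃-syntax; _,_; proj₁; proj₂)
open import Data.Product.Properties using (≡-dec)
open import Data.Sum using (_⊎_; inj₁; inj₂)
open import Data.Empty using (⊥-elim)
open import Function.Base using (_∘_)
open import Function.Bundles using (_⇔_; mk⇔)
open import Relation.Nullary using (Dec; yes; no; ¬?)
open import Relation.Nullary.Decidable using (True; toWitness; map′; _×-dec_; _⊎-dec_; _→-dec_)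
open import Relation.Binary using (DecidableEquality)
open import Relation.Binary.PropositionalEquality using (_≡_; refl; sym)

_≟ᵥ_ : DecidableEquality V
_≟ᵥ_ = ≡-dec _≟_ _≟_

allᵥ? : {P : V → Set} → (∀ v → Dec (P v)) → Dec (∀ v → P v)
allᵥ? P? = map′ (λ h (i , j) → h i j) (λ h i j → h (i , j)) (all? λ i → all? λ j → P? (i , j))

adj? : ∀ u v → Dec (Adj u v)
adj? (i , _) (j , _) = ¬? (i ≟ j)

record CycleSystem : Set where
  constructor cycleSystem
  field
    count length : ℕ
    cycle : Fin count → Fin length → V

open CycleSystem

module _ (C : CycleSystem) where

  CycleEdge : V → V → Set
  CycleEdge u v = ∃[ i ] ∃[ x ]
    ((u ≡ cycle C i x × v ≡ cycle C i (next x)) ⊎ (v ≡ cycle C i x × u ≡ cycle C i (next x)))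

  VertexPartition : Set
  VertexPartition = (∀ i j x y → cycle C i x ≡ cycle C j y → i ≡ j × x ≡ y)
                  × (∀ v → ∃[ i ] ∃[ x ] cycle C i x ≡ v)

  InGraph : Set
  InGraph = ∀ i x → Adj (cycle C i x) (cycle C i (next x))

  cycleEdge? : ∀ u v → Dec (CycleEdge u v)
  cycleEdge? u v = any? λ i → any? λ x →
      ((u ≟ᵥ cycle C i x) ×-dec (v ≟ᵥ cycle C i (next x)))
    ⊎-dec ((v ≟ᵥ cycle C i x) ×-dec (u ≟ᵥ cycle C i (next x)))

  vertexPartition? : Dec VertexPartition
  vertexPartition? =
    (all? λ i → all? λ j → all? λ x → all? λ y →
       (cycle C i x ≟ᵥ cycle C j y) →-dec ((i ≟ j) ×-dec (x ≟ y)))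
    ×-dec (allᵥ? λ v → any? λ i → any? λ x → cycle C i x ≟ᵥ v)

  inGraph? : Dec InGraph
  inGraph? = all? λ i → all? λ x → adj? (cycle C i x) (cycle C i (next x))

CycleEdge-sym : ∀ C {u v} → CycleEdge C u v → CycleEdge C v u
CycleEdge-sym C (i , x , inj₁ e) = i , x , inj₂ e
CycleEdge-sym C (i , x , inj₂ e) = i , x , inj₁ e

CycleEdge⇒Adj : ∀ C {u v} → InGraph C → CycleEdge C u v → Adj u v
CycleEdge⇒Adj C inGraph (i , x , inj₁ (refl , refl)) = inGraph i x
CycleEdge⇒Adj C inGraph (i , x , inj₂ (refl , refl)) = inGraph i x ∘ sym

isCkFactor : ∀ {E} C → 3 ≤ length C → VertexPartition C →
             (∀ u v → E u v ⇔ CycleEdge C u v) → IsCkFactor (length C) E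
isCkFactor C 3≤k (injective , surjective) edges =
  3≤k , count C , cycle C , injective , surjective , edges

module _ {n : ℕ} (F : Fin (suc n) → CycleSystem) where

  EdgeDisjoint : Set
  EdgeDisjoint = ∀ s t i x →
    CycleEdge (F t) (cycle (F s) i x) (cycle (F s) i (next x)) → s ≡ t

  Covers : Set
  Covers = ∀ u v → Adj u v → ∃[ t ] CycleEdge (F t) u v

  edgeDisjoint? : Dec EdgeDisjoint
  edgeDisjoint? = all? λ s → all? λ t → all? λ i → all? λ x →
    cycleEdge? (F t) (cycle (F s) i x) (cycle (F s) i (next x)) →-dec (s ≟ t)

  covers? : Dec Covers
  covers? = allᵥ? λ u → allᵥ? λ v → adj? u v →-dec any? λ t → cycleEdge? (F t) u v

module Colouring {n : ℕ} (F : Fin (suc n) → CycleSystem) where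

  -- Pairs lying in no factor get the junk colour zero.
  colour : V → V → Fin (suc n)
  colour u v with any? (λ t → cycleEdge? (F t) u v)
  ... | yes (t , _) = t
  ... | no _ = zero

  edge-unique : ∀ {u v s t} → EdgeDisjoint F → CycleEdge (F s) u v → CycleEdge (F t) u v → s ≡ t
  edge-unique {s = s} {t} disjoint (i , x , inj₁ (refl , refl)) e = disjoint s t i x e
  edge-unique {s = s} {t} disjoint (i , x , inj₂ (refl , refl)) e =
    disjoint s t i x (CycleEdge-sym (F t) e)

  colour-edge : ∀ {u v t} → EdgeDisjoint F → CycleEdge (F t) u v → colour u v ≡ t
  colour-edge {u} {v} disjoint e with any? (λ t → cycleEdge? (F t) u v)
  ... | yes (_ , e′) = edge-unique disjoint e′ e
  ... | no ∄e = ⊥-elim (∄e (_ , e))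

  colour-covered : ∀ {u v} → Covers F → Adj u v → CycleEdge (F (colour u v)) u v
  colour-covered {u} {v} covers a with any? (λ t → cycleEdge? (F t) u v)
  ... | yes (_ , e) = e
  ... | no ∄e = ⊥-elim (∄e (covers u v a))

  colour-sym : ∀ {u v} → EdgeDisjoint F → colour u v ≡ colour v u
  colour-sym {u} {v} disjoint with any? (λ t → cycleEdge? (F t) u v)
  ... | yes (t , e) = sym (colour-edge disjoint (CycleEdge-sym (F t) e))
  ... | no ∄e with any? (λ t → cycleEdge? (F t) v u)
  ...   | yes (t , e) = ⊥-elim (∄e (t , CycleEdge-sym (F t) e))
  ...   | no _ = refl

CycleType : ℕ → (Fin 7 → CycleSystem) → Set
CycleType α F = ∀ t → (toℕ t < α → length (F t) ≡ 3) × (α ≤ toℕ t → length (F t) ≡ 7)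

record TwoFactorization (α : ℕ) (F : Fin 7 → CycleSystem) : Set where
  field
    vertexPartition : ∀ t → VertexPartition (F t)
    inGraph         : ∀ t → InGraph (F t)
    edgeDisjoint    : EdgeDisjoint F
    covers          : Covers F
    cycleType       : CycleType α F

twoFactorization? : ∀ α F → Dec (TwoFactorization α F)
twoFactorization? α F = map′
  (λ (p , g , d , c , τ) → record
    { vertexPartition = p ; inGraph = g ; edgeDisjoint = d ; covers = c ; cycleType = τ })
  (λ T → let open TwoFactorization T in
    vertexPartition , inGraph , edgeDisjoint , covers , cycleType)
  ((all? λ t → vertexPartition? (F t)) ×-dec (all? λ t → inGraph? (F t))
    ×-dec edgeDisjoint? F ×-dec covers? F
    ×-dec (all? λ t → ((toℕ t <? α) →-dec (length (F t) ℕ.≟ 3))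
                 ×-dec ((α ≤? toℕ t) →-dec (length (F t) ℕ.≟ 7))))

hasFactorization : ∀ {α F} → TwoFactorization α F → HasFactorization α
hasFactorization {α} {F} T = colour , (λ _ _ → colour-sym edgeDisjoint) , λ t →
    (λ t<α → factor t ℕ.≤-refl (proj₁ (cycleType t) t<α))
  , (λ α≤t → factor t (ℕ.m≤m+n 3 4) (proj₂ (cycleType t) α≤t))
  where
  open TwoFactorization T
  open Colouring F
  edges : ∀ t u v → FactorEdges colour t u v ⇔ CycleEdge (F t) u v
  edges t u v = mk⇔
    (λ { (a , refl) → colour-covered covers a })
    (λ e → CycleEdge⇒Adj (F t) (inGraph t) e , colour-edge edgeDisjoint e)
  factor : ∀ t {k} → 3 ≤ k → length (F t) ≡ k → IsCkFactor k (FactorEdges colour t)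
  factor t 3≤k refl = isCkFactor (F t) 3≤k (vertexPartition t) (edges t)

verifiedFactorization : ∀ α F → {True (twoFactorization? α F)} → HasFactorization α
verifiedFactorization α F {certificate} = hasFactorization (toWitness certificate)

triangleFactor : ℕ → ℕ → CycleSystem
triangleFactor a b = cycleSystem 7 3 triangle
  where
  triangle : Fin 7 → Fin 3 → V
  triangle i zero             = # 0 , i
  triangle i (suc zero)       = # 1 , iterate next i a
  triangle i (suc (suc zero)) = # 2 , iterate next i b

-- Vertex k of a table is vertex k mod 7 of part ⌊k / 7⌋.
tableFactor : ∀ {m k} → Vec (Vec ℕ k) m → CycleSystem
tableFactor {m} {k} table = cycleSystem m k λ i x → remQuot 7 (lookup (lookup table i) x mod 21)

F₀ : Fin 7 → CycleSystem
F₀ = lookup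
  ( tableFactor
      ( (0 ∷ 18 ∷ 11 ∷ 16 ∷ 5 ∷ 20 ∷ 10 ∷ [])
      ∷ (1 ∷ 8 ∷ 4 ∷ 12 ∷ 17 ∷ 7 ∷ 15 ∷ [])
      ∷ (2 ∷ 9 ∷ 19 ∷ 3 ∷ 14 ∷ 6 ∷ 13 ∷ [])
      ∷ [])
  ∷ tableFactor
      ( (0 ∷ 20 ∷ 11 ∷ 4 ∷ 10 ∷ 1 ∷ 19 ∷ [])
      ∷ (2 ∷ 18 ∷ 13 ∷ 16 ∷ 12 ∷ 14 ∷ 7 ∷ [])
      ∷ (3 ∷ 9 ∷ 6 ∷ 17 ∷ 5 ∷ 15 ∷ 8 ∷ [])
      ∷ [])
  ∷ tableFactor
      ( (0 ∷ 16 ∷ 4 ∷ 19 ∷ 7 ∷ 18 ∷ 12 ∷ [])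
      ∷ (1 ∷ 14 ∷ 11 ∷ 2 ∷ 8 ∷ 6 ∷ 20 ∷ [])
      ∷ (3 ∷ 15 ∷ 9 ∷ 5 ∷ 13 ∷ 17 ∷ 10 ∷ [])
      ∷ [])
  ∷ tableFactor
      ( (0 ∷ 9 ∷ 16 ∷ 10 ∷ 6 ∷ 18 ∷ 8 ∷ [])
      ∷ (1 ∷ 17 ∷ 3 ∷ 7 ∷ 20 ∷ 2 ∷ 12 ∷ [])
      ∷ (4 ∷ 15 ∷ 13 ∷ 19 ∷ 11 ∷ 5 ∷ 14 ∷ [])
      ∷ [])
  ∷ tableFactor
      ( (0 ∷ 15 ∷ 12 ∷ 19 ∷ 6 ∷ 11 ∷ 17 ∷ [])
      ∷ (1 ∷ 7 ∷ 5 ∷ 10 ∷ 18 ∷ 4 ∷ 9 ∷ [])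
      ∷ (2 ∷ 16 ∷ 8 ∷ 20 ∷ 3 ∷ 13 ∷ 14 ∷ [])
      ∷ [])
  ∷ tableFactor
      ( (0 ∷ 13 ∷ 1 ∷ 11 ∷ 15 ∷ 10 ∷ 14 ∷ [])
      ∷ (2 ∷ 17 ∷ 9 ∷ 18 ∷ 5 ∷ 8 ∷ 19 ∷ [])
      ∷ (3 ∷ 16 ∷ 6 ∷ 7 ∷ 4 ∷ 20 ∷ 12 ∷ [])
      ∷ [])
  ∷ tableFactor
      ( (0 ∷ 11 ∷ 3 ∷ 18 ∷ 1 ∷ 16 ∷ 7 ∷ [])
      ∷ (2 ∷ 10 ∷ 19 ∷ 5 ∷ 12 ∷ 6 ∷ 15 ∷ [])
      ∷ (4 ∷ 17 ∷ 8 ∷ 14 ∷ 9 ∷ 20 ∷ 13 ∷ [])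
      ∷ [])
  ∷ [])

F₁ : Fin 7 → CycleSystem
F₁ = lookup
  ( triangleFactor 6 5
  ∷ tableFactor
      ( (0 ∷ 7 ∷ 16 ∷ 1 ∷ 12 ∷ 20 ∷ 8 ∷ [])
      ∷ (2 ∷ 13 ∷ 14 ∷ 3 ∷ 18 ∷ 11 ∷ 19 ∷ [])
      ∷ (4 ∷ 17 ∷ 9 ∷ 5 ∷ 10 ∷ 6 ∷ 15 ∷ [])
      ∷ [])
  ∷ tableFactor
      ( (0 ∷ 20 ∷ 11 ∷ 2 ∷ 17 ∷ 10 ∷ 14 ∷ [])
      ∷ (1 ∷ 18 ∷ 8 ∷ 5 ∷ 19 ∷ 12 ∷ 15 ∷ [])
      ∷ (3 ∷ 16 ∷ 9 ∷ 4 ∷ 13 ∷ 6 ∷ 7 ∷ [])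
      ∷ [])
  ∷ tableFactor
      ( (0 ∷ 9 ∷ 18 ∷ 4 ∷ 11 ∷ 1 ∷ 10 ∷ [])
      ∷ (2 ∷ 12 ∷ 14 ∷ 7 ∷ 17 ∷ 13 ∷ 20 ∷ [])
      ∷ (3 ∷ 8 ∷ 15 ∷ 5 ∷ 16 ∷ 6 ∷ 19 ∷ [])
      ∷ [])
  ∷ tableFactor
      ( (0 ∷ 18 ∷ 10 ∷ 15 ∷ 2 ∷ 16 ∷ 12 ∷ [])
      ∷ (1 ∷ 19 ∷ 8 ∷ 17 ∷ 6 ∷ 20 ∷ 9 ∷ [])
      ∷ (3 ∷ 13 ∷ 5 ∷ 7 ∷ 4 ∷ 14 ∷ 11 ∷ [])
      ∷ [])
  ∷ tableFactor
      ( (0 ∷ 15 ∷ 7 ∷ 18 ∷ 13 ∷ 16 ∷ 11 ∷ [])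
      ∷ (1 ∷ 8 ∷ 6 ∷ 14 ∷ 5 ∷ 12 ∷ 17 ∷ [])
      ∷ (2 ∷ 10 ∷ 3 ∷ 20 ∷ 4 ∷ 19 ∷ 9 ∷ [])
      ∷ [])
  ∷ tableFactor
      ( (0 ∷ 17 ∷ 3 ∷ 12 ∷ 4 ∷ 8 ∷ 16 ∷ [])
      ∷ (1 ∷ 14 ∷ 9 ∷ 6 ∷ 11 ∷ 15 ∷ 13 ∷ [])
      ∷ (2 ∷ 7 ∷ 19 ∷ 10 ∷ 20 ∷ 5 ∷ 18 ∷ [])
      ∷ [])
  ∷ [])

F₃ : Fin 7 → CycleSystem
F₃ = lookup
  ( triangleFactor 2 4
  ∷ triangleFactor 4 1
  ∷ triangleFactor 6 5
  ∷ tableFactor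
      ( (0 ∷ 7 ∷ 19 ∷ 9 ∷ 14 ∷ 11 ∷ 16 ∷ [])
      ∷ (1 ∷ 8 ∷ 3 ∷ 10 ∷ 18 ∷ 4 ∷ 17 ∷ [])
      ∷ (2 ∷ 12 ∷ 20 ∷ 6 ∷ 13 ∷ 5 ∷ 15 ∷ [])
      ∷ [])
  ∷ tableFactor
      ( (0 ∷ 10 ∷ 5 ∷ 14 ∷ 1 ∷ 13 ∷ 20 ∷ [])
      ∷ (2 ∷ 19 ∷ 6 ∷ 16 ∷ 9 ∷ 4 ∷ 7 ∷ [])
      ∷ (3 ∷ 17 ∷ 12 ∷ 15 ∷ 8 ∷ 18 ∷ 11 ∷ [])
      ∷ [])
  ∷ tableFactor
      ( (0 ∷ 17 ∷ 10 ∷ 15 ∷ 6 ∷ 7 ∷ 14 ∷ [])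
      ∷ (1 ∷ 9 ∷ 2 ∷ 16 ∷ 3 ∷ 13 ∷ 18 ∷ [])
      ∷ (4 ∷ 20 ∷ 8 ∷ 5 ∷ 12 ∷ 19 ∷ 11 ∷ [])
      ∷ [])
  ∷ tableFactor
      ( (0 ∷ 12 ∷ 4 ∷ 14 ∷ 13 ∷ 16 ∷ 8 ∷ [])
      ∷ (1 ∷ 15 ∷ 7 ∷ 17 ∷ 9 ∷ 6 ∷ 11 ∷ [])
      ∷ (2 ∷ 18 ∷ 5 ∷ 19 ∷ 3 ∷ 20 ∷ 10 ∷ [])
      ∷ [])
  ∷ [])

F₅ : Fin 7 → CycleSystem
F₅ = lookup
  ( triangleFactor 0 0
  ∷ triangleFactor 1 2
  ∷ triangleFactor 2 4
  ∷ triangleFactor 3 1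
  ∷ triangleFactor 4 3
  ∷ tableFactor
      ( (0 ∷ 12 ∷ 15 ∷ 2 ∷ 7 ∷ 1 ∷ 13 ∷ [])
      ∷ (3 ∷ 8 ∷ 18 ∷ 5 ∷ 17 ∷ 4 ∷ 16 ∷ [])
      ∷ (6 ∷ 11 ∷ 14 ∷ 10 ∷ 20 ∷ 9 ∷ 19 ∷ [])
      ∷ [])
  ∷ tableFactor
      ( (0 ∷ 19 ∷ 8 ∷ 2 ∷ 14 ∷ 1 ∷ 20 ∷ [])
      ∷ (3 ∷ 9 ∷ 4 ∷ 10 ∷ 5 ∷ 11 ∷ 15 ∷ [])
      ∷ (6 ∷ 12 ∷ 16 ∷ 13 ∷ 17 ∷ 7 ∷ 18 ∷ [])
      ∷ [])
  ∷ [])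

F₇ : Fin 7 → CycleSystem
F₇ = lookup
  ( triangleFactor 0 0
  ∷ triangleFactor 1 2
  ∷ triangleFactor 2 4
  ∷ triangleFactor 3 6
  ∷ triangleFactor 4 1
  ∷ triangleFactor 5 3
  ∷ triangleFactor 6 5
  ∷ [])

lemma2p7 : (α : ℕ) → (α ≡ 0 ⊎ α ≡ 1 ⊎ α ≡ 3 ⊎ α ≡ 5 ⊎ α ≡ 7) → HasFactorization α
lemma2p7 _ (inj₁ refl)                      = verifiedFactorization 0 F₀
lemma2p7 _ (inj₂ (inj₁ refl))               = verifiedFactorization 1 F₁
lemma2p7 _ (inj₂ (inj₂ (inj₁ refl)))        = verifiedFactorization 3 F₃
lemma2p7 _ (inj₂ (inj₂ (inj₂ (inj₁ refl)))) = verifiedFactorization 5 F₅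
lemma2p7 _ (inj₂ (inj₂ (inj₂ (inj₂ refl)))) = verifiedFactorization 7 F₇
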